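{- Let $\mathbf P=(P,\leq)$ be a poset and $T$ a non-trivial tolerance on $\mathbf P$. Then every block of $T$ is directed and convex.
   Context: For a poset $\mathbf P=(P,\leq)$ and $x,y\in P$, $x\vee y$ and $x\wedge y$ denote the supremum and infimum of $\{x,y\}$ in $\mathbf P$ (when they exist). A tolerance on $\mathbf P$ is a reflexive and symmetric binary relation $T$ on $P$ satisfying: (1) if $(x,y),(z,u)\in T$ and $x\vee z$ and $y\vee u$ exist then $(x\vee z,y\vee u)\in T$; (2) if $(x,y),(z,u)\in T$ and $x\wedge z$ and $y\wedge u$ exist then $(x\wedge z,y\wedge u)\in T$; (3) if $x,y,z\in P$, $(x,y),(y,z)\in T$ and $T\neq P^2$, then there exist $u,v\in P$ with $u\leq x,y,z\leq v$ and $(u,y),(y,v)\in T$; (4) if $(x,y)\in T$ and $T\neq P^2$, then there exists some $(z,u)\in T$ with $z\leq x,y\leq u$ and such that $(v,z),(v,u)\in T$ for all $v\in P$ with $(v,x),(v,y)\in T$. The trivial tolerances are $\{(x,x)\mid x\in P\}$ and $P^2$; a tolerance is non-trivial if it is neither of these. A block of $T$ is a maximal subset $B\subseteq P$ with $B^2\subseteq T$. A subset $A\subseteq P$ is directed if for all $x,y\in A$ there exist $z,u\in A$ with $z\leq x,y\leq u$; it is convex if for all $x,y\in A$ with $x\leq y$ we have $[x,y]=\{w\in P\mid x\le w\le y\}\subseteq A$. -}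

module Defs where

open import Data.Product using (Σ; _×_; _,_; ∃₂)
open import Data.Sum using (_⊎_)
open import Relation.Nullary using (¬_)
open import Relation.Binary.PropositionalEquality using (_≡_)
open import Relation.Binary.Structures using (IsPartialOrder)

module _ {P : Set} (_≤_ : P → P → Set) where

  IsSup : P → P → P → Set
  IsSup x y s = (x ≤ s) × (y ≤ s) × (∀ w → x ≤ w → y ≤ w → s ≤ w)

  IsInf : P → P → P → Set
  IsInf x y i = (i ≤ x) × (i ≤ y) × (∀ w → w ≤ x → w ≤ y → w ≤ i)

  IsFull : (P → P → Set) → Set
  IsFull T = ∀ x y → T x y

  IsDiagonal : (P → P → Set) → Set
  IsDiagonal T = (∀ x → T x x) × (∀ x y → T x y → x ≡ y)

  record IsTolerance (T : P → P → Set) : Set where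
    field
      refl  : ∀ x → T x x
      sym   : ∀ x y → T x y → T y x
      sup-compat : ∀ x y z u s₁ s₂ → T x y → T z u →
                   IsSup x z s₁ → IsSup y u s₂ → T s₁ s₂
      inf-compat : ∀ x y z u i₁ i₂ → T x y → T z u →
                   IsInf x z i₁ → IsInf y u i₂ → T i₁ i₂
      cond3 : ¬ IsFull T → ∀ x y z → T x y → T y z →
              Σ P λ u → Σ P λ v →
                (u ≤ x) × (u ≤ y) × (u ≤ z) ×
                (x ≤ v) × (y ≤ v) × (z ≤ v) ×
                T u y × T y v
      cond4 : ¬ IsFull T → ∀ x y → T x y →
              Σ P λ z → Σ P λ u →
                T z u × (z ≤ x) × (z ≤ y) × (x ≤ u) × (y ≤ u) ×
                (∀ v → T v x → T v y → T v z × T v u)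

  NonTrivial : (P → P → Set) → Set
  NonTrivial T = ¬ IsDiagonal T × ¬ IsFull T

  SquareIn : (P → P → Set) → (P → Set) → Set
  SquareIn T B = ∀ x y → B x → B y → T x y

  IsBlock : (P → P → Set) → (P → Set) → Set₁
  IsBlock T B = SquareIn T B ×
    (∀ (C : P → Set) → SquareIn T C → (∀ x → B x → C x) → ∀ x → C x → B x)

  Directed : (P → Set) → Set
  Directed A = ∀ x y → A x → A y →
    Σ P λ z → Σ P λ u → A z × A u × (z ≤ x) × (z ≤ y) × (x ≤ u) × (y ≤ u)

  Convex : (P → Set) → Set
  Convex A = ∀ x y → A x → A y → x ≤ y → ∀ w → x ≤ w → w ≤ y → A w

-- A block B absorbs every element w with B × {w} ⊆ T, by maximality.  Condition (4)
-- bounds a pair x, y of B by elements z ≤ x, y ≤ u tolerated by everything that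
-- tolerates both x and y, hence by all of B; so z, u ∈ B and B is directed.  For
-- convexity let x ≤ w ≤ y with x, y ∈ B and b ∈ B; choose z ∈ B below b and x.  On
-- comparable elements suprema and infima are the larger and smaller element, so (1)
-- and (2) make T closed under shrinking intervals: T z y gives T z w, condition (3)
-- for b T z T w gives a common upper bound q with T z q, hence T b q and T w q,
-- and meeting these with q gives T b w.
module Submission where

open import Defs
open import Data.Product using (_×_; _,_; proj₁; proj₂)
open import Data.Sum using (_⊎_; inj₁; inj₂)
open import Relation.Nullary using (¬_)
open import Relation.Binary.PropositionalEquality using (_≡_; refl)
open import Relation.Binary.Structures using (IsPartialOrder)

module _ {P : Set} {_≤_ : P → P → Set} (≤-refl : ∀ {x} → x ≤ x) where

  IsSup-≤ : ∀ {a b} → a ≤ b → IsSup _≤_ a b b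
  IsSup-≤ a≤b = a≤b , ≤-refl , λ _ _ b≤w → b≤w

  IsSup-≥ : ∀ {a b} → a ≤ b → IsSup _≤_ b a b
  IsSup-≥ a≤b = ≤-refl , a≤b , λ _ b≤w _ → b≤w

  IsInf-≤ : ∀ {a b} → a ≤ b → IsInf _≤_ a b a
  IsInf-≤ a≤b = ≤-refl , a≤b , λ _ w≤a _ → w≤a

  IsInf-≥ : ∀ {a b} → a ≤ b → IsInf _≤_ b a a
  IsInf-≥ a≤b = a≤b , ≤-refl , λ _ _ w≤a → w≤a

  module _ {T : P → P → Set} (tol : IsTolerance _≤_ T) where
    open IsTolerance tol renaming (refl to T-refl; sym to T-sym)

    tolerance-shrinkˡ : ∀ {a b c} → T a c → a ≤ b → b ≤ c → T b c
    tolerance-shrinkˡ {a} {b} {c} Tac a≤b b≤c =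
      sup-compat a c b b b c Tac (T-refl b) (IsSup-≤ a≤b) (IsSup-≥ b≤c)

    tolerance-shrinkʳ : ∀ {a b c} → T a c → a ≤ b → b ≤ c → T a b
    tolerance-shrinkʳ {a} {b} {c} Tac a≤b b≤c =
      inf-compat a c b b a b Tac (T-refl b) (IsInf-≤ a≤b) (IsInf-≥ b≤c)

    tolerance-below : ∀ {a b q} → T a q → T b q → a ≤ q → b ≤ q → T a b
    tolerance-below {a} {b} {q} Taq Tbq a≤q b≤q =
      inf-compat q b a q a b (T-sym b q Tbq) Taq (IsInf-≥ a≤q) (IsInf-≤ b≤q)

module _ {P : Set} {_≤_ : P → P → Set} {T : P → P → Set} {B : P → Set} where

  block-absorbs : (∀ x → T x x) → (∀ x y → T x y → T y x) → IsBlock _≤_ T B →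
                  ∀ w → (∀ b → B b → T b w) → B w
  block-absorbs T-refl T-sym (B²⊆T , maximal) w Tw =
    maximal (λ v → B v ⊎ v ≡ w) B∪w²⊆T (λ _ → inj₁) w (inj₂ refl)
    where
    B∪w²⊆T : SquareIn _≤_ T (λ v → B v ⊎ v ≡ w)
    B∪w²⊆T a b (inj₁ Ba) (inj₁ Bb) = B²⊆T a b Ba Bb
    B∪w²⊆T a .w (inj₁ Ba) (inj₂ refl) = Tw a Ba
    B∪w²⊆T .w b (inj₂ refl) (inj₁ Bb) = T-sym b w (Tw b Bb)
    B∪w²⊆T .w .w (inj₂ refl) (inj₂ refl) = T-refl w

  module _ (tol : IsTolerance _≤_ T) (T≢P² : ¬ IsFull _≤_ T) (block : IsBlock _≤_ T B) where
    open IsTolerance tol renaming (refl to T-refl; sym to T-sym)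
    private
      B²⊆T : SquareIn _≤_ T B
      B²⊆T = proj₁ block
      absorbs : ∀ w → (∀ b → B b → T b w) → B w
      absorbs = block-absorbs T-refl T-sym block

    block-directed : Directed _≤_ B
    block-directed x y Bx By with cond4 T≢P² x y (B²⊆T x y Bx By)
    ... | z , u , _ , z≤x , z≤y , x≤u , y≤u , bounds =
      z , u , absorbs z (λ b Bb → proj₁ (bounds′ b Bb)) ,
              absorbs u (λ b Bb → proj₂ (bounds′ b Bb)) ,
      z≤x , z≤y , x≤u , y≤u
      where
      bounds′ : ∀ b → B b → T b z × T b u
      bounds′ b Bb = bounds b (B²⊆T b x Bb Bx) (B²⊆T b y Bb By)

    block-convex : IsPartialOrder _≡_ _≤_ → Convex _≤_ B
    block-convex po x y Bx By _ w x≤w w≤y = absorbs w tolerates-w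
      where
      open IsPartialOrder po using (reflexive; trans)
      ≤-refl : ∀ {a} → a ≤ a
      ≤-refl = reflexive refl

      tolerates-w : ∀ b → B b → T b w
      tolerates-w b Bb with block-directed b x Bb Bx
      ... | z , _ , Bz , _ , z≤b , z≤x , _ with
            cond3 T≢P² b z w (B²⊆T b z Bb Bz)
                  (tolerance-shrinkʳ ≤-refl tol (B²⊆T z y Bz By) (trans z≤x x≤w) w≤y)
      ... | _ , q , _ , _ , _ , b≤q , _ , w≤q , _ , Tzq =
        tolerance-below ≤-refl tol
          (tolerance-shrinkˡ ≤-refl tol Tzq z≤b b≤q)
          (tolerance-shrinkˡ ≤-refl tol Tzq (trans z≤x x≤w) w≤q)
          b≤q w≤q

theorem1 : (P : Set) (_≤_ : P → P → Set) → IsPartialOrder _≡_ _≤_ →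
    (T : P → P → Set) → IsTolerance _≤_ T → NonTrivial _≤_ T →
    (B : P → Set) → IsBlock _≤_ T B →
    Directed _≤_ B × Convex _≤_ B
theorem1 P _≤_ po T tol (_ , T≢P²) B block =
  block-directed tol T≢P² block , block-convex tol T≢P² block po
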